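{- In any strong AMD code over a group of order $n$, for every source $s$ one has $\hat\epsilon_s\ge\frac{a-a_s}{n-1}$, where $a_s=|A(s)|$ and $a$ is the total number of valid encodings.
   Context: Let $\mathcal{G}$ be a finite additive abelian group of order $n\ge2$ and $\mathcal{S}$ a set of $m$ sources. An AMD code consists of pairwise disjoint nonempty subsets $A(s)\subseteq\mathcal{G}$ ($s\in\mathcal{S}$) and a (possibly randomized) public encoding function $E$ mapping $s$ to some $g\in A(s)$ with probability $\Pr[E(s)=g]$. Write $a_s=|A(s)|$, $a=\sum_s a_s$. Strong security game for a source $s$: the source $s$ is given to the adversary, who then chooses $\Delta\in\mathcal{G}\setminus\{0\}$ by a (possibly randomized) strategy depending on $s$; then $g=E(s)$ is computed; the adversary wins iff $g+\Delta\in A(s')$ for some $s'\ne s$. $\hat\epsilon_s$ is the maximum winning probability over all strategies for source $s$.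
   Formalization: The encoding probabilities $\Pr[E(s)=g]$ take values in the rationals, and the adversary's strategy achieving the bound is taken with rational probabilities. -}

module Defs where

open import Data.Nat as ℕ using (ℕ; zero; suc; _∸_; _≤_; s≤s)
open import Data.Integer using (+_)
open import Data.Rational using (ℚ; _/_; 0ℚ; 1ℚ; _+_; _*_) renaming (_≤_ to _≤ℚ_)
open import Data.Fin using (Fin; zero; suc; _≟_)
open import Data.Fin.Subset using (Subset; _∈_; _∉_; ∣_∣; Nonempty)
open import Data.Vec using (lookup)
open import Data.Bool using (Bool; true; false; not; _∧_; _∨_)
open import Data.Product using (Σ; _×_; ∃)
open import Data.Empty using (⊥)
open import Relation.Nullary using (¬_)
open import Relation.Nullary.Decidable using (⌊_⌋)
open import Relation.Binary.PropositionalEquality using (_≡_; _≢_)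
open import Algebra.Structures using (IsAbelianGroup)

sumFin : ∀ {k} → (Fin k → ℚ) → ℚ
sumFin {zero}  f = 0ℚ
sumFin {suc k} f = f zero + sumFin (λ i → f (suc i))

sumFinℕ : ∀ {k} → (Fin k → ℕ) → ℕ
sumFinℕ {zero}  f = 0
sumFinℕ {suc k} f = f zero ℕ.+ sumFinℕ (λ i → f (suc i))

anyFin : ∀ {k} → (Fin k → Bool) → Bool
anyFin {zero}  p = false
anyFin {suc k} p = p zero ∨ anyFin (λ i → p (suc i))

IsDistribution : ∀ {k} → (Fin k → ℚ) → Set
IsDistribution {k} p = (∀ i → 0ℚ ≤ℚ p i) × sumFin p ≡ 1ℚ

-- A finite abelian group of order n, carried by Fin n (every finite
-- abelian group of order n is isomorphic to one of these).
record FinAbGroup (n : ℕ) : Set where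
  field
    _⊕_   : Fin n → Fin n → Fin n
    𝟘     : Fin n
    ⊖_    : Fin n → Fin n
    isAbelianGroup : IsAbelianGroup _≡_ _⊕_ 𝟘 ⊖_

-- An AMD code over the group G with m sources (sources are Fin m).
-- A s : the set of valid encodings of source s.
-- E s g : Pr[E(s) = g].
record AMDCode {n : ℕ} (G : FinAbGroup n) (m : ℕ) : Set where
  field
    A : Fin m → Subset n
    E : Fin m → Fin n → ℚ
    nonempty : ∀ s → Nonempty (A s)
    disjoint : ∀ s s' g → s ≢ s' → g ∈ A s → g ∈ A s' → ⊥
    E-dist   : ∀ s → IsDistribution (E s)
    E-support : ∀ s g → g ∉ A s → E s g ≡ 0ℚ

  total : ℕ
  total = sumFinℕ (λ s → ∣ A s ∣)

  open FinAbGroup G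

  hitsOther : Fin m → Fin n → Bool
  hitsOther s h = anyFin (λ s' → not ⌊ s' ≟ s ⌋ ∧ lookup (A s') h)

  indicator : Bool → ℚ
  indicator true  = 1ℚ
  indicator false = 0ℚ

  -- A (randomized) adversary strategy for source s: a distribution σ on
  -- the group putting no mass on 0.
  IsStrategy : (Fin n → ℚ) → Set
  IsStrategy σ = IsDistribution σ × σ 𝟘 ≡ 0ℚ

  winProb : Fin m → (Fin n → ℚ) → ℚ
  winProb s σ = sumFin (λ Δ → sumFin (λ g → σ Δ * (E s g * indicator (hitsOther s (g ⊕ Δ)))))

bound : (n : ℕ) → 2 ≤ n → ℕ → ℚ
bound (suc (suc k)) (s≤s (s≤s _)) x = (+ x) / suc k

-- The adversary picks the shift Δ uniformly among the n - 1 nonzero elements.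
-- For an encoding g ∈ A(s) the shift 0 would never win, since g lies in no
-- other A(s'); so given g the adversary wins with probability
-- #{Δ | g + Δ ∈ ⋃_{s' ≠ s} A(s')} / (n - 1), and as Δ ↦ g + Δ is a bijection
-- this is |⋃_{s' ≠ s} A(s')| / (n - 1) whatever g is.  By disjointness the union
-- has at least a - a_s elements (double counting over the pairs (s', h) with h ∈ A(s')).
module Submission where

open import Defs
open import Data.Nat using (ℕ; _≤_; _∸_)
open import Data.Fin using (Fin)
open import Data.Fin.Subset using (∣_∣)
open import Data.Product using (Σ; _×_)
open import Data.Rational using (ℚ) renaming (_≤_ to _≤ℚ_)

open import Algebra.Bundles using (Group; CommutativeRing)
import Algebra.Properties.CommutativeMonoid.Sum as CommutativeMonoidSum
import Algebra.Properties.CommutativeSemigroup as CommutativeSemigroupProperties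
import Algebra.Properties.Group as GroupProperties
import Algebra.Properties.Semiring.Sum as SemiringSum
open import Algebra.Structures using (IsAbelianGroup)
open import Data.Bool using (Bool; true; false; not; _∧_)
open import Data.Bool.Properties using (∧-zeroʳ)
open import Data.Empty using (⊥-elim)
open import Data.Fin using (zero; suc; _≟_)
open import Data.Fin.Permutation using (Permutation′; permutation)
open import Data.Fin.Properties using (suc-injective)
open import Data.Fin.Subset using (Subset; _∉_)
open import Data.Integer as ℤ using (+_)
import Data.Integer.Properties as ℤP
open import Data.Nat as ℕ using (zero; suc; z≤n; s≤s)
import Data.Nat.Properties as ℕP
open import Data.Product using (_,_; proj₂)
open import Data.Rational as ℚ using (0ℚ; 1ℚ; toℚᵘ)
import Data.Rational.Properties as ℚP
open import Data.Rational.Unnormalised as ℚᵘ using (mkℚᵘ; *≡*; *≤*)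
import Data.Rational.Unnormalised.Properties as ℚᵘP
open import Data.Vec using ([]; _∷_; lookup)
open import Data.Vec.Properties using (lookup⇒[]=; []=⇒lookup)
open import Function using (_∘_)
open import Relation.Nullary using (Dec; yes; no)
open import Relation.Nullary.Decidable using (⌊_⌋)
open import Relation.Binary.PropositionalEquality

module ℚΣ = SemiringSum (CommutativeRing.semiring ℚP.+-*-commutativeRing)
module ℕΣ = CommutativeMonoidSum ℕP.+-0-commutativeMonoid

sumFin≡sum : ∀ {k} (f : Fin k → ℚ) → sumFin f ≡ ℚΣ.sum f
sumFin≡sum {zero}  f = refl
sumFin≡sum {suc k} f = cong (f zero ℚ.+_) (sumFin≡sum (f ∘ suc))

sumFinℕ≡sum : ∀ {k} (f : Fin k → ℕ) → sumFinℕ f ≡ ℕΣ.sum f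
sumFinℕ≡sum {zero}  f = refl
sumFinℕ≡sum {suc k} f = cong (f zero ℕ.+_) (sumFinℕ≡sum (f ∘ suc))

sum-mono-≤ : ∀ {k} {f g : Fin k → ℕ} → (∀ i → f i ≤ g i) → ℕΣ.sum f ≤ ℕΣ.sum g
sum-mono-≤ {zero}  f≤g = z≤n
sum-mono-≤ {suc k} f≤g = ℕP.+-mono-≤ (f≤g zero) (sum-mono-≤ (f≤g ∘ suc))

χ : Bool → ℕ
χ true  = 1
χ false = 0

count : ∀ {k} → (Fin k → Bool) → ℕ
count p = ℕΣ.sum (χ ∘ p)

∣p∣≡count : ∀ {n} (p : Subset n) → ∣ p ∣ ≡ count (lookup p)
∣p∣≡count []          = refl
∣p∣≡count (true ∷ p)  = cong suc (∣p∣≡count p)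
∣p∣≡count (false ∷ p) = ∣p∣≡count p

lookup≡false⇒∉ : ∀ {n} {p : Subset n} {i : Fin n} → lookup p i ≡ false → i ∉ p
lookup≡false⇒∉ pi≡false i∈p with () ← trans (sym ([]=⇒lookup i∈p)) pi≡false

count-true : ∀ k → count {k} (λ _ → true) ≡ k
count-true zero    = refl
count-true (suc k) = cong suc (count-true k)

count-false : ∀ {k} {p : Fin k → Bool} → (∀ i → p i ≡ false) → count p ≡ 0
count-false {zero}  p≡false = refl
count-false {suc k} p≡false rewrite p≡false zero = count-false (p≡false ∘ suc)

anyFin-false : ∀ {k} {p : Fin k → Bool} → (∀ i → p i ≡ false) → anyFin p ≡ false
anyFin-false {zero}  p≡false = refl
anyFin-false {suc k} p≡false rewrite p≡false zero = anyFin-false (p≡false ∘ suc)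

AtMostOne : ∀ {k} → (Fin k → Bool) → Set
AtMostOne p = ∀ i j → p i ≡ true → p j ≡ true → i ≡ j

count≤χ-anyFin : ∀ {k} (p : Fin k → Bool) → AtMostOne p → count p ≤ χ (anyFin p)
count≤χ-anyFin {zero}  p unique = z≤n
count≤χ-anyFin {suc k} p unique with p zero in p0
... | true  = s≤s (ℕP.≤-reflexive (count-false rest-false))
  where
  rest-false : ∀ i → p (suc i) ≡ false
  rest-false i with p (suc i) in pi
  ... | true  with () ← unique zero (suc i) p0 pi
  ... | false = refl
... | false = count≤χ-anyFin (p ∘ suc) λ i j pi pj → suc-injective (unique (suc i) (suc j) pi pj)

except : ∀ {k} → Fin k → (Fin k → Bool) → Fin k → Bool
except s p i = not ⌊ i ≟ s ⌋ ∧ p i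

except-self : ∀ {k} (s : Fin k) (p : Fin k → Bool) → except s p s ≡ false
except-self s p with s ≟ s
... | yes _   = refl
... | no s≢s  = ⊥-elim (s≢s refl)

except-true : ∀ {k} {s i : Fin k} (p : Fin k → Bool) → except s p i ≡ true → p i ≡ true
except-true {s = s} {i} p e with ⌊ i ≟ s ⌋
... | false = e

except-unique : ∀ {k} {s : Fin k} {p : Fin k → Bool} →
                AtMostOne p → p s ≡ true → ∀ i → except s p i ≡ false
except-unique {s = s} {p} unique ps i with p i in pi
... | false = ∧-zeroʳ (not ⌊ i ≟ s ⌋)
... | true  rewrite unique i s pi ps = except-self s (λ _ → true)

except-atMostOne : ∀ {k} {s : Fin k} {p : Fin k → Bool} → AtMostOne p → AtMostOne (except s p)
except-atMostOne {p = p} unique i j pi pj = unique i j (except-true p pi) (except-true p pj)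

-- Not definitional: the two decisions are about different propositions.
⌊suc≟suc⌋ : ∀ {k} (i s : Fin k) → ⌊ suc i ≟ suc s ⌋ ≡ ⌊ i ≟ s ⌋
⌊suc≟suc⌋ i s with i ≟ s
... | yes _ = refl
... | no _  = refl

count-except : ∀ {k} (p : Fin k → Bool) (s : Fin k) → count p ≡ χ (p s) ℕ.+ count (except s p)
count-except p zero    = refl
count-except p (suc s) = begin
  χ (p zero) ℕ.+ count (p ∘ suc)
    ≡⟨ cong (χ (p zero) ℕ.+_) (count-except (p ∘ suc) s) ⟩
  χ (p zero) ℕ.+ (χ (p (suc s)) ℕ.+ count (except s (p ∘ suc)))
    ≡⟨ x∙yz≈y∙xz (χ (p zero)) (χ (p (suc s))) _ ⟩
  χ (p (suc s)) ℕ.+ (χ (p zero) ℕ.+ count (except s (p ∘ suc)))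
    ≡⟨ cong (λ c → χ (p (suc s)) ℕ.+ (χ (p zero) ℕ.+ c)) (ℕΣ.sum-cong-≗ except-suc) ⟩
  χ (p (suc s)) ℕ.+ count (except (suc s) p) ∎
  where
  open ≡-Reasoning
  open CommutativeSemigroupProperties ℕP.+-commutativeSemigroup using (x∙yz≈y∙xz)
  except-suc : ∀ i → χ (except s (p ∘ suc) i) ≡ χ (except (suc s) p (suc i))
  except-suc i = cong (λ b → χ (not b ∧ p (suc i))) (sym (⌊suc≟suc⌋ i s))

fromℕ : ℕ → ℚ
fromℕ x = + x ℚ./ 1

toℚᵘ-fromℕ : ∀ x → toℚᵘ (fromℕ x) ℚᵘ.≃ mkℚᵘ (+ x) 0
toℚᵘ-fromℕ x = ℚP.toℚᵘ-fromℚᵘ (mkℚᵘ (+ x) 0)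

fromℕ-homo-+ : ∀ m n → fromℕ (m ℕ.+ n) ≡ fromℕ m ℚ.+ fromℕ n
fromℕ-homo-+ m n = ℚP.toℚᵘ-injective (begin
  toℚᵘ (fromℕ (m ℕ.+ n))
    ≈⟨ toℚᵘ-fromℕ (m ℕ.+ n) ⟩
  mkℚᵘ (+ (m ℕ.+ n)) 0
    ≈⟨ *≡* (cong (ℤ._* + 1) +-as-ℚᵘ) ⟩
  mkℚᵘ (+ m) 0 ℚᵘ.+ mkℚᵘ (+ n) 0
    ≈⟨ ℚᵘP.+-cong (toℚᵘ-fromℕ m) (toℚᵘ-fromℕ n) ⟨
  toℚᵘ (fromℕ m) ℚᵘ.+ toℚᵘ (fromℕ n)
    ≈⟨ ℚP.toℚᵘ-homo-+ (fromℕ m) (fromℕ n) ⟨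
  toℚᵘ (fromℕ m ℚ.+ fromℕ n) ∎)
  where
  open ℚᵘP.≃-Reasoning
  +-as-ℚᵘ : + (m ℕ.+ n) ≡ + m ℤ.* + 1 ℤ.+ + n ℤ.* + 1
  +-as-ℚᵘ = trans (ℤP.pos-+ m n)
                  (sym (cong₂ ℤ._+_ (ℤP.*-identityʳ (+ m)) (ℤP.*-identityʳ (+ n))))

fromℕ-mono-≤ : ∀ {m n} → m ≤ n → fromℕ m ≤ℚ fromℕ n
fromℕ-mono-≤ {m} {n} m≤n = ℚP.toℚᵘ-cancel-≤ (begin
  toℚᵘ (fromℕ m)  ≃⟨ toℚᵘ-fromℕ m ⟩
  mkℚᵘ (+ m) 0    ≤⟨ *≤* (ℤP.*-monoʳ-≤-nonNeg (+ 1) (ℤ.+≤+ m≤n)) ⟩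
  mkℚᵘ (+ n) 0    ≃⟨ toℚᵘ-fromℕ n ⟨
  toℚᵘ (fromℕ n)  ∎)
  where open ℚᵘP.≤-Reasoning

sum-fromℕ : ∀ {k} (f : Fin k → ℕ) → ℚΣ.sum (fromℕ ∘ f) ≡ fromℕ (ℕΣ.sum f)
sum-fromℕ {zero}  f = refl
sum-fromℕ {suc k} f = begin
  fromℕ (f zero) ℚ.+ ℚΣ.sum (fromℕ ∘ f ∘ suc)
    ≡⟨ cong (fromℕ (f zero) ℚ.+_) (sum-fromℕ (f ∘ suc)) ⟩
  fromℕ (f zero) ℚ.+ fromℕ (ℕΣ.sum (f ∘ suc))
    ≡⟨ fromℕ-homo-+ (f zero) (ℕΣ.sum (f ∘ suc)) ⟨
  fromℕ (ℕΣ.sum f) ∎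
  where open ≡-Reasoning

/-as-* : ∀ x k → + x ℚ./ suc k ≡ (+ 1 ℚ./ suc k) ℚ.* fromℕ x
/-as-* x k = ℚP.toℚᵘ-injective (begin
  toℚᵘ (+ x ℚ./ suc k)
    ≈⟨ ℚP.toℚᵘ-fromℚᵘ (mkℚᵘ (+ x) k) ⟩
  mkℚᵘ (+ x) k
    ≈⟨ *≡* (cong₂ ℤ._*_ (sym (ℤP.*-identityˡ (+ x))) (cong +_ (ℕP.*-identityʳ (suc k)))) ⟩
  mkℚᵘ (+ 1) k ℚᵘ.* mkℚᵘ (+ x) 0
    ≈⟨ ℚᵘP.*-cong (ℚP.toℚᵘ-fromℚᵘ (mkℚᵘ (+ 1) k)) (toℚᵘ-fromℕ x) ⟨
  toℚᵘ (+ 1 ℚ./ suc k) ℚᵘ.* toℚᵘ (fromℕ x)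
    ≈⟨ ℚP.toℚᵘ-homo-* (+ 1 ℚ./ suc k) (fromℕ x) ⟨
  toℚᵘ ((+ 1 ℚ./ suc k) ℚ.* fromℕ x) ∎)
  where open ℚᵘP.≃-Reasoning

n/n≡1 : ∀ k → + suc k ℚ./ suc k ≡ 1ℚ
n/n≡1 k = ℚP.toℚᵘ-injective
  (ℚᵘP.≃-trans (ℚP.toℚᵘ-fromℚᵘ (mkℚᵘ (+ suc k) k)) (*≡* (ℤP.*-comm (+ suc k) (+ 1))))

0≤/ : ∀ x k → 0ℚ ≤ℚ + x ℚ./ suc k
0≤/ x k = ℚP.nonNegative⁻¹ (+ x ℚ./ suc k) {{ℚP.normalize-nonNeg x (suc k)}}

sum-translate : ∀ {n} (G : FinAbGroup n) (f : Fin n → ℚ) (g : Fin n) →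
                ℚΣ.sum (λ Δ → f (FinAbGroup._⊕_ G g Δ)) ≡ ℚΣ.sum f
sum-translate {n} G f g = sym (ℚΣ.sum-permute f translation)
  where
  open FinAbGroup G
  group : Group _ _
  group = record { isGroup = IsAbelianGroup.isGroup isAbelianGroup }
  open Group group using (_\\_)
  open GroupProperties group using (\\-leftDividesˡ; \\-leftDividesʳ)
  translation : Permutation′ n
  translation = permutation (g ⊕_) (g \\_) (\\-leftDividesˡ g) (\\-leftDividesʳ g)

module UniformAttack {k m} (G : FinAbGroup (suc (suc k))) (C : AMDCode G m) (s : Fin m) where
  open AMDCode C
  open FinAbGroup G
  open IsAbelianGroup isAbelianGroup using (identityʳ)

  c : ℚ
  c = + 1 ℚ./ suc k

  nonzero : Fin (suc (suc k)) → Bool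
  nonzero = except 𝟘 (λ _ → true)

  σ : Fin (suc (suc k)) → ℚ
  σ Δ = c ℚ.* fromℕ (χ (nonzero Δ))

  count-nonzero : count nonzero ≡ suc k
  count-nonzero = sym (ℕP.suc-injective
    (trans (sym (count-true (suc (suc k)))) (count-except (λ _ → true) 𝟘)))

  σ-isStrategy : IsStrategy σ
  σ-isStrategy = (σ-nonNeg , σ-sum) , σ-𝟘
    where
    σ-nonNeg : ∀ Δ → 0ℚ ≤ℚ σ Δ
    σ-nonNeg Δ = subst (0ℚ ≤ℚ_) (/-as-* (χ (nonzero Δ)) k) (0≤/ (χ (nonzero Δ)) k)
    σ-sum : sumFin σ ≡ 1ℚ
    σ-sum = begin
      sumFin σ                             ≡⟨ sumFin≡sum σ ⟩
      ℚΣ.sum σ                             ≡⟨ ℚΣ.*-distribˡ-sum c (fromℕ ∘ χ ∘ nonzero) ⟨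
      c ℚ.* ℚΣ.sum (fromℕ ∘ χ ∘ nonzero)   ≡⟨ cong (c ℚ.*_) (sum-fromℕ (χ ∘ nonzero)) ⟩
      c ℚ.* fromℕ (count nonzero)          ≡⟨ cong (λ x → c ℚ.* fromℕ x) count-nonzero ⟩
      c ℚ.* fromℕ (suc k)                  ≡⟨ /-as-* (suc k) k ⟨
      + suc k ℚ./ suc k                    ≡⟨ n/n≡1 k ⟩
      1ℚ                                   ∎
      where open ≡-Reasoning
    σ-𝟘 : σ 𝟘 ≡ 0ℚ
    σ-𝟘 rewrite except-self 𝟘 (λ _ → true) = ℚP.*-zeroʳ c

  hit : Fin (suc (suc k)) → ℚ
  hit h = fromℕ (χ (hitsOther s h))

  N : ℕ
  N = count (hitsOther s)

  -- `hitsOther s h` is definitionally `anyFin (except s (owners h))`.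
  owners : Fin (suc (suc k)) → Fin m → Bool
  owners h s' = lookup (A s') h

  atMostOne-owners : ∀ h → AtMostOne (owners h)
  atMostOne-owners h i j hi hj with i ≟ j
  ... | yes i≡j = i≡j
  ... | no  i≢j = ⊥-elim (disjoint i j h i≢j (lookup⇒[]= h (A i) hi) (lookup⇒[]= h (A j) hj))

  hitsOther-A : ∀ {g} → lookup (A s) g ≡ true → hitsOther s g ≡ false
  hitsOther-A {g} g∈A = anyFin-false (except-unique (atMostOne-owners g) g∈A)

  σ-nonzero : ∀ {Δ} → Δ ≢ 𝟘 → σ Δ ≡ c
  σ-nonzero {Δ} Δ≢𝟘 with Δ ≟ 𝟘
  ... | yes Δ≡𝟘 = ⊥-elim (Δ≢𝟘 Δ≡𝟘)
  ... | no  _   = ℚP.*-identityʳ c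

  σ-weight : ∀ {g} → lookup (A s) g ≡ true → ∀ Δ → σ Δ ℚ.* hit (g ⊕ Δ) ≡ c ℚ.* hit (g ⊕ Δ)
  σ-weight {g} g∈A Δ = by-cases (Δ ≟ 𝟘)
    where
    by-cases : Dec (Δ ≡ 𝟘) → σ Δ ℚ.* hit (g ⊕ Δ) ≡ c ℚ.* hit (g ⊕ Δ)
    by-cases (no Δ≢𝟘) = cong (ℚ._* hit (g ⊕ Δ)) (σ-nonzero Δ≢𝟘)
    by-cases (yes Δ≡𝟘) = begin
      σ Δ ℚ.* hit (g ⊕ Δ)  ≡⟨ cong (σ Δ ℚ.*_) no-hit ⟩
      σ Δ ℚ.* 0ℚ           ≡⟨ ℚP.*-zeroʳ (σ Δ) ⟩
      0ℚ                   ≡⟨ ℚP.*-zeroʳ c ⟨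
      c ℚ.* 0ℚ             ≡⟨ cong (c ℚ.*_) no-hit ⟨
      c ℚ.* hit (g ⊕ Δ)    ∎
      where
      open ≡-Reasoning
      no-hit : hit (g ⊕ Δ) ≡ 0ℚ
      no-hit = cong (fromℕ ∘ χ) (trans (cong (hitsOther s ∘ (g ⊕_)) Δ≡𝟘)
                                       (trans (cong (hitsOther s) (identityʳ g)) (hitsOther-A g∈A)))

  support-weight : ∀ g Δ → E s g ℚ.* (σ Δ ℚ.* hit (g ⊕ Δ)) ≡ E s g ℚ.* (c ℚ.* hit (g ⊕ Δ))
  support-weight g Δ with lookup (A s) g in g∈A
  ... | true  = cong (E s g ℚ.*_) (σ-weight g∈A Δ)
  ... | false rewrite E-support s g (lookup≡false⇒∉ g∈A) =
    trans (ℚP.*-zeroˡ (σ Δ ℚ.* hit (g ⊕ Δ))) (sym (ℚP.*-zeroˡ (c ℚ.* hit (g ⊕ Δ))))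

  winProb≡ : winProb s σ ≡ c ℚ.* fromℕ N
  winProb≡ = begin
    winProb s σ
      ≡⟨ sumFin≡sum (λ Δ → sumFin (payoff Δ)) ⟩
    ℚΣ.sum (λ Δ → sumFin (payoff Δ))
      ≡⟨ ℚΣ.sum-cong-≗ (λ Δ → sumFin≡sum (payoff Δ)) ⟩
    ℚΣ.sum (λ Δ → ℚΣ.sum (payoff Δ))
      ≡⟨ ℚΣ.∑-comm payoff ⟩
    ℚΣ.sum (λ g → ℚΣ.sum (λ Δ → payoff Δ g))
      ≡⟨ ℚΣ.sum-cong-≗ (λ g → ℚΣ.sum-cong-≗ (payoff≡ g)) ⟩
    ℚΣ.sum (λ g → ℚΣ.sum (λ Δ → E s g ℚ.* (c ℚ.* hit (g ⊕ Δ))))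
      ≡⟨ ℚΣ.sum-cong-≗ row ⟩
    ℚΣ.sum (λ g → E s g ℚ.* (c ℚ.* fromℕ N))
      ≡⟨ ℚΣ.*-distribʳ-sum (c ℚ.* fromℕ N) (E s) ⟨
    ℚΣ.sum (E s) ℚ.* (c ℚ.* fromℕ N)
      ≡⟨ cong (ℚ._* (c ℚ.* fromℕ N)) (trans (sym (sumFin≡sum (E s))) (proj₂ (E-dist s))) ⟩
    1ℚ ℚ.* (c ℚ.* fromℕ N)
      ≡⟨ ℚP.*-identityˡ (c ℚ.* fromℕ N) ⟩
    c ℚ.* fromℕ N ∎
    where
    open ≡-Reasoning
    open CommutativeSemigroupProperties
      (CommutativeRing.*-commutativeSemigroup ℚP.+-*-commutativeRing) using (x∙yz≈y∙xz)
    indicator≡fromℕ∘χ : ∀ b → indicator b ≡ fromℕ (χ b)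
    indicator≡fromℕ∘χ true  = refl
    indicator≡fromℕ∘χ false = refl
    payoff : Fin (suc (suc k)) → Fin (suc (suc k)) → ℚ
    payoff Δ g = σ Δ ℚ.* (E s g ℚ.* indicator (hitsOther s (g ⊕ Δ)))
    payoff≡ : ∀ g Δ → payoff Δ g ≡ E s g ℚ.* (c ℚ.* hit (g ⊕ Δ))
    payoff≡ g Δ = begin
      σ Δ ℚ.* (E s g ℚ.* indicator (hitsOther s (g ⊕ Δ)))
        ≡⟨ cong (λ x → σ Δ ℚ.* (E s g ℚ.* x)) (indicator≡fromℕ∘χ (hitsOther s (g ⊕ Δ))) ⟩
      σ Δ ℚ.* (E s g ℚ.* hit (g ⊕ Δ))  ≡⟨ x∙yz≈y∙xz (σ Δ) (E s g) (hit (g ⊕ Δ)) ⟩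
      E s g ℚ.* (σ Δ ℚ.* hit (g ⊕ Δ))  ≡⟨ support-weight g Δ ⟩
      E s g ℚ.* (c ℚ.* hit (g ⊕ Δ))    ∎
    row : ∀ g → ℚΣ.sum (λ Δ → E s g ℚ.* (c ℚ.* hit (g ⊕ Δ))) ≡ E s g ℚ.* (c ℚ.* fromℕ N)
    row g = begin
      ℚΣ.sum (λ Δ → E s g ℚ.* (c ℚ.* hit (g ⊕ Δ)))
        ≡⟨ ℚΣ.*-distribˡ-sum (E s g) (λ Δ → c ℚ.* hit (g ⊕ Δ)) ⟨
      E s g ℚ.* ℚΣ.sum (λ Δ → c ℚ.* hit (g ⊕ Δ))
        ≡⟨ cong (E s g ℚ.*_) (ℚΣ.*-distribˡ-sum c (λ Δ → hit (g ⊕ Δ))) ⟨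
      E s g ℚ.* (c ℚ.* ℚΣ.sum (λ Δ → hit (g ⊕ Δ)))
        ≡⟨ cong (λ x → E s g ℚ.* (c ℚ.* x)) (sum-translate G hit g) ⟩
      E s g ℚ.* (c ℚ.* ℚΣ.sum hit)
        ≡⟨ cong (λ x → E s g ℚ.* (c ℚ.* x)) (sum-fromℕ (χ ∘ hitsOther s)) ⟩
      E s g ℚ.* (c ℚ.* fromℕ N) ∎

  total∸∣As∣≤N : total ∸ ∣ A s ∣ ≤ N
  total∸∣As∣≤N = ℕP.m≤n+o⇒m∸n≤o total ∣ A s ∣ (begin
    total
      ≡⟨ sumFinℕ≡sum (λ s' → ∣ A s' ∣) ⟩
    ℕΣ.sum (λ s' → ∣ A s' ∣)
      ≡⟨ ℕΣ.sum-cong-≗ (∣p∣≡count ∘ A) ⟩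
    ℕΣ.sum (λ s' → count (lookup (A s')))
      ≡⟨ ℕΣ.∑-comm (λ s' h → χ (lookup (A s') h)) ⟩
    ℕΣ.sum (λ h → count (owners h))
      ≡⟨ ℕΣ.sum-cong-≗ (λ h → count-except (owners h) s) ⟩
    ℕΣ.sum (λ h → χ (lookup (A s) h) ℕ.+ count (except s (owners h)))
      ≡⟨ ℕΣ.∑-distrib-+ (χ ∘ lookup (A s)) (λ h → count (except s (owners h))) ⟩
    count (lookup (A s)) ℕ.+ ℕΣ.sum (λ h → count (except s (owners h)))
      ≤⟨ ℕP.+-mono-≤ (ℕP.≤-reflexive (sym (∣p∣≡count (A s))))
           (sum-mono-≤ λ h → count≤χ-anyFin _ (except-atMostOne {s = s} (atMostOne-owners h))) ⟩
    ∣ A s ∣ ℕ.+ N ∎)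
    where open ℕP.≤-Reasoning

mainTheorem13 : (n : ℕ) (hn : 2 ≤ n) (G : FinAbGroup n) (m : ℕ) (C : AMDCode G m) (s : Fin m) →
    Σ (Fin n → ℚ) (λ σ → AMDCode.IsStrategy C σ ×
      bound n hn (AMDCode.total C ∸ ∣ AMDCode.A C s ∣) ≤ℚ AMDCode.winProb C s σ)
mainTheorem13 (suc (suc k)) (s≤s (s≤s z≤n)) G m C s = σ , σ-isStrategy , (begin
  + (total ∸ ∣ A s ∣) ℚ./ suc k  ≡⟨ /-as-* (total ∸ ∣ A s ∣) k ⟩
  c ℚ.* fromℕ (total ∸ ∣ A s ∣)  ≤⟨ ℚP.*-monoˡ-≤-nonNeg c {{ℚP.normalize-nonNeg 1 (suc k)}}
                                      (fromℕ-mono-≤ total∸∣As∣≤N) ⟩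
  c ℚ.* fromℕ N                  ≡⟨ winProb≡ ⟨
  winProb s σ                    ∎)
  where
  open AMDCode C using (A; total; winProb)
  open UniformAttack G C s
  open ℚP.≤-Reasoning
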